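{- Let $X$, $Y$ be finite nonempty sets, and let $F: X\to 2^Y$ be a set-valued mapping with $F(x)\ne\emptyset$ for all $x\in X$ such that $X$ is a non-reducible set of $F$. Then (i) $F$ satisfies the Hall condition; (ii) for each $x\in X$ and $y\in F(x)$, the mapping $F_{\{x\},\{y\}}$ satisfies the Hall condition.
   Context: A set-valued mapping $F: X \to 2^Y$ assigns to each $x$ a (possibly empty) subset $F(x) \subset Y$; $F(W) = \bigcup_{x\in W}F(x)$; $\sharp$ is cardinality. A set-valued mapping $G$ with domain $D$ satisfies the Hall condition if $\sharp G(W)\ge\sharp W$ for all $W\subset D$. For $W\subset X$ and $Z\subset Y$, $F_{W,Z}: X\setminus W\to 2^{Y\setminus Z}$ is $F_{W,Z}(x) = F(x)\setminus Z$. A subset $W\subset X$ is critical for $F$ if $W\ne\emptyset$ and $\sharp F(W)=\sharp W$; non-reducible for $F$ if $W\ne\emptyset$ and no proper subset of $W$ is critical for $F$. -}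

module Defs where

open import Data.Nat using (ℕ; zero; suc; _≤_)
open import Data.Bool using (Bool; true; false)
open import Data.Fin using (Fin; zero; suc)
open import Data.Fin.Subset using (Subset; ⊥; _∪_; _─_; _⊆_; _⊂_; ∣_∣; Nonempty)
open import Data.Vec using (_∷_; [])
open import Data.Product using (_×_)
open import Relation.Nullary using (¬_)
open import Relation.Binary.PropositionalEquality using (_≡_)

SetMap : ℕ → ℕ → Set
SetMap m n = Fin m → Subset n

image : ∀ {m n} → SetMap m n → Subset m → Subset n
image {zero}  F []          = ⊥
image {suc m} F (true ∷ W)  = F zero ∪ image (λ i → F (suc i)) W
image {suc m} F (false ∷ W) = image (λ i → F (suc i)) W

Hall : ∀ {m n} → SetMap m n → Subset m → Set
Hall G D = ∀ W → W ⊆ D → ∣ W ∣ ≤ ∣ image G W ∣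

-- F_{W,Z} : X \ W → 2^{Y \ Z},  F_{W,Z}(x) = F(x) \ Z.
-- (Its domain X \ W is ∁ W; values outside the domain are irrelevant.)
restrict : ∀ {m n} → SetMap m n → Subset m → Subset n → SetMap m n
restrict F W Z x = F x ─ Z

Critical : ∀ {m n} → SetMap m n → Subset m → Set
Critical F W = Nonempty W × (∣ image F W ∣ ≡ ∣ W ∣)

NonReducible : ∀ {m n} → SetMap m n → Subset m → Set
NonReducible F W = Nonempty W × (∀ V → V ⊂ W → ¬ Critical F V)

-- A non-reducible X has no critical proper subset, so every nonempty proper
-- subset W satisfying Hall's inequality has surplus: ♯W < ♯F(W).
-- (i) By induction on W: removing x ∈ W leaves W - x, which has surplus (or is
-- empty, when F(x) ≠ ∅ does the job), so ♯W ≤ 1 + ♯(W - x) ≤ ♯F(W - x) ≤ ♯F(W).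
-- (ii) Deleting y from the values lowers ♯F(W) by at most one, which the
-- surplus of W ⊆ X ∖ {x} absorbs.
module Submission where

open import Defs
open import Data.Bool using (true; false)
open import Data.Fin using (Fin; zero; suc)
open import Data.Fin.Subset
  using (Subset; ⊤; ∁; ⁅_⁆; _∈_; _∉_; Nonempty; Empty; _─_; _-_; _⊆_; _⊂_; ∣_∣)
open import Data.Fin.Subset.Induction using (Acc; acc; ⊂-wellFounded)
open import Data.Fin.Subset.Properties
  using ( x∈p∪q⁻; x∈p∪q⁺; x∈p∧x∉q⇒x∈p─q; p─q⊆p; p─⊥≡p; x∈p⇒p-x⊂p
        ; p⊆q⇒∣p∣≤∣q∣; ⊆-trans; ⊂-⊆-trans; ⊆⊤; ∈⊤; x∈⁅x⁆; x∈p⇒x∉∁p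
        ; ∣p∣≤∣x∷p∣; Empty-unique; ∣⊥∣≡0; nonempty?; ∉⊥)
open import Data.Nat using (ℕ; suc; _≤_; _<_; z≤n; s≤s)
open import Data.Nat.Properties
  using (≤-reflexive; ≤-trans; ≤-pred; n≤1+n; ≤∧≢⇒<; module ≤-Reasoning)
open import Data.Product using (∃; _×_; _,_; proj₁; proj₂)
open import Data.Sum using (inj₁; inj₂)
open import Data.Vec using ([]; _∷_; here; there)
open import Relation.Nullary using (yes; no)
open import Relation.Nullary.Negation using (contradiction)
open import Relation.Binary.PropositionalEquality using (_≡_; sym; trans; cong)

private
  variable
    m n : ℕ

x∈p─q⇒x∉q : ∀ {p q : Subset n} {x} → x ∈ p ─ q → x ∉ q
x∈p─q⇒x∉q {p = _ ∷ _} {q = true ∷ _}  ()           here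
x∈p─q⇒x∉q {p = _ ∷ _} {q = _ ∷ _}     (there x∈p─q) (there x∈q) = x∈p─q⇒x∉q x∈p─q x∈q

x∈p⇒0<∣p∣ : ∀ {p : Subset n} {x} → x ∈ p → 0 < ∣ p ∣
x∈p⇒0<∣p∣ here                      = s≤s z≤n
x∈p⇒0<∣p∣ {p = s ∷ p} (there x∈p) = ≤-trans (x∈p⇒0<∣p∣ x∈p) (∣p∣≤∣x∷p∣ s p)

Empty⇒∣p∣≡0 : ∀ {p : Subset n} → Empty p → ∣ p ∣ ≡ 0
Empty⇒∣p∣≡0 {n} ¬ne = trans (cong ∣_∣ (Empty-unique ¬ne)) (∣⊥∣≡0 n)

∣p∣≤1+∣p-x∣ : ∀ (p : Subset n) x → ∣ p ∣ ≤ suc ∣ p - x ∣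
∣p∣≤1+∣p-x∣ (true  ∷ p) zero    = s≤s (≤-reflexive (cong ∣_∣ (sym (p─⊥≡p p))))
∣p∣≤1+∣p-x∣ (false ∷ p) zero    = ≤-trans (n≤1+n _) (s≤s (≤-reflexive (cong ∣_∣ (sym (p─⊥≡p p)))))
∣p∣≤1+∣p-x∣ (true  ∷ p) (suc x) = s≤s (∣p∣≤1+∣p-x∣ p x)
∣p∣≤1+∣p-x∣ (false ∷ p) (suc x) = ∣p∣≤1+∣p-x∣ p x

⊆∁⁅x⁆⇒⊂⊤ : ∀ {p : Subset n} {x} → p ⊆ ∁ ⁅ x ⁆ → p ⊂ ⊤
⊆∁⁅x⁆⇒⊂⊤ {x = x} p⊆∁⁅x⁆ = ⊆⊤ , x , ∈⊤ , λ x∈p → x∈p⇒x∉∁p (x∈⁅x⁆ x) (p⊆∁⁅x⁆ x∈p)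

∈-image⁺ : ∀ (F : SetMap m n) {W x y} → x ∈ W → y ∈ F x → y ∈ image F W
∈-image⁺ F {true ∷ W}  here        y∈Fx = x∈p∪q⁺ (inj₁ y∈Fx)
∈-image⁺ F {true ∷ W}  (there x∈W) y∈Fx = x∈p∪q⁺ (inj₂ (∈-image⁺ (λ i → F (suc i)) x∈W y∈Fx))
∈-image⁺ F {false ∷ W} (there x∈W) y∈Fx = ∈-image⁺ (λ i → F (suc i)) x∈W y∈Fx

∈-image⁻ : ∀ (F : SetMap m n) W {y} → y ∈ image F W → ∃ λ x → x ∈ W × y ∈ F x
∈-image⁻ F [] y∈∅ = contradiction y∈∅ ∉⊥
∈-image⁻ F (true ∷ W) y∈FW with x∈p∪q⁻ (F zero) (image (λ i → F (suc i)) W) y∈FW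
... | inj₁ y∈F0 = zero , here , y∈F0
... | inj₂ y∈FW′ with ∈-image⁻ (λ i → F (suc i)) W y∈FW′
...   | x , x∈W , y∈Fx = suc x , there x∈W , y∈Fx
∈-image⁻ F (false ∷ W) y∈FW with ∈-image⁻ (λ i → F (suc i)) W y∈FW
... | x , x∈W , y∈Fx = suc x , there x∈W , y∈Fx

module _ (F : SetMap m n) where

  image-mono : ∀ {V W} → V ⊆ W → image F V ⊆ image F W
  image-mono {V} V⊆W y∈FV with ∈-image⁻ F V y∈FV
  ... | x , x∈V , y∈Fx = ∈-image⁺ F (V⊆W x∈V) y∈Fx

  image─⊆image-restrict : ∀ A Z W → image F W ─ Z ⊆ image (restrict F A Z) W
  image─⊆image-restrict A Z W y∈ with ∈-image⁻ F W (p─q⊆p _ Z y∈)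
  ... | x , x∈W , y∈Fx = ∈-image⁺ (restrict F A Z) x∈W (x∈p∧x∉q⇒x∈p─q y∈Fx (x∈p─q⇒x∉q y∈))

  ∣image∣≤1+∣image-restrict∣ : ∀ A y W
    → ∣ image F W ∣ ≤ suc ∣ image (restrict F A ⁅ y ⁆) W ∣
  ∣image∣≤1+∣image-restrict∣ A y W = ≤-trans (∣p∣≤1+∣p-x∣ (image F W) y)
    (s≤s (p⊆q⇒∣p∣≤∣q∣ (image─⊆image-restrict A ⁅ y ⁆ W)))

module _ {F : SetMap m n} {D : Subset m} (nonReducible : NonReducible F D) where

  nonReducible⇒surplus : ∀ {W} → W ⊂ D → Nonempty W
    → ∣ W ∣ ≤ ∣ image F W ∣ → ∣ W ∣ < ∣ image F W ∣
  nonReducible⇒surplus W⊂D ne ∣W∣≤∣FW∣ =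
    ≤∧≢⇒< ∣W∣≤∣FW∣ (λ ∣W∣≡∣FW∣ → proj₂ nonReducible _ W⊂D (ne , sym ∣W∣≡∣FW∣))

  nonReducible⇒Hall : (∀ {x} → x ∈ D → Nonempty (F x)) → Hall F D
  nonReducible⇒Hall nonemptyValues W = go W (⊂-wellFounded W)
    where
    go : ∀ W → Acc _⊂_ W → W ⊆ D → ∣ W ∣ ≤ ∣ image F W ∣
    go W (acc rec) W⊆D with nonempty? W
    ... | no ¬ne = ≤-trans (≤-reflexive (Empty⇒∣p∣≡0 ¬ne)) z≤n
    ... | yes (x , x∈W) = ≤-trans (∣p∣≤1+∣p-x∣ W x) 1+∣W-x∣≤∣FW∣
      where
      W-x⊂W : W - x ⊂ W
      W-x⊂W = x∈p⇒p-x⊂p x∈W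

      1+∣W-x∣≤∣FW∣ : suc ∣ W - x ∣ ≤ ∣ image F W ∣
      1+∣W-x∣≤∣FW∣ with nonempty? (W - x)
      ... | yes ne = ≤-trans
        (nonReducible⇒surplus (⊂-⊆-trans W-x⊂W W⊆D) ne
          (go (W - x) (rec W-x⊂W) (⊆-trans (proj₁ W-x⊂W) W⊆D)))
        (p⊆q⇒∣p∣≤∣q∣ (image-mono F (proj₁ W-x⊂W)))
      ... | no ¬ne rewrite Empty⇒∣p∣≡0 ¬ne =
        x∈p⇒0<∣p∣ (∈-image⁺ F x∈W (proj₂ (nonemptyValues (W⊆D x∈W))))

  restrict-Hall : Hall F D → ∀ A y W → W ⊂ D
    → ∣ W ∣ ≤ ∣ image (restrict F A ⁅ y ⁆) W ∣
  restrict-Hall hall A y W W⊂D with nonempty? W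
  ... | no ¬ne = ≤-trans (≤-reflexive (Empty⇒∣p∣≡0 ¬ne)) z≤n
  ... | yes ne = ≤-pred (begin-strict
    ∣ W ∣                                  <⟨ nonReducible⇒surplus W⊂D ne (hall W (proj₁ W⊂D)) ⟩
    ∣ image F W ∣                          ≤⟨ ∣image∣≤1+∣image-restrict∣ F A y W ⟩
    suc ∣ image (restrict F A ⁅ y ⁆) W ∣   ∎)
    where open ≤-Reasoning

lemma2p6 : (m n : ℕ) → 0 < m → 0 < n → (F : SetMap m n)
    → (∀ x → Nonempty (F x))
    → NonReducible F ⊤
    → Hall F ⊤
      × (∀ (x : Fin m) (y : Fin n) → y ∈ F x
          → Hall (restrict F ⁅ x ⁆ ⁅ y ⁆) (∁ ⁅ x ⁆))
lemma2p6 m n _ _ F nonemptyValues nonReducible = hall , restrictedHall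
  where
  hall : Hall F ⊤
  hall = nonReducible⇒Hall nonReducible (λ {x} _ → nonemptyValues x)

  restrictedHall : ∀ x y → y ∈ F x → Hall (restrict F ⁅ x ⁆ ⁅ y ⁆) (∁ ⁅ x ⁆)
  restrictedHall x y _ W W⊆∁⁅x⁆ =
    restrict-Hall nonReducible hall ⁅ x ⁆ y W (⊆∁⁅x⁆⇒⊂⊤ W⊆∁⁅x⁆)
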